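{- The graph $G_\omega=(\omega^\omega,E_\omega)$ defined below is triangle-free. Here $E_\omega=\bigcup_{n\in\omega,\,1\le i\leq 4}\left(E^n_i\cup(E^n_i)^{ -1}\right)$, where $E^n_1=\{(\alpha,\beta)\in L_{n-1}\times L_n:\ \beta=\alpha+\omega^{n}\}$, $E^n_2=\{(\alpha,\beta)\in L_n\times L_{n-2}:\ \alpha<\beta\}$, $E^n_3=\{(\alpha,\beta)\in L_{n-3}\times L_n:\ \alpha<\beta,\ \alpha\not\sqsubset\beta,\ \max_i\beta_i<\alpha_{n-1}\}$, $E^n_4=\{(\alpha,\beta)\in L_{n-4}\times L_n:\ \alpha<\beta,\ \alpha\not\sqsubset\beta,\ \max_i\beta_i>\alpha_{n-1}+\alpha_{n-2}\}$.
   Context: For $0<\alpha<\omega^\omega$ write its Cantor normal form as $\alpha=\sum_i\omega^i\cdot\alpha_i$ with natural coefficients $\alpha_i$ (all $\alpha_i=0$ for $\alpha=0$); $\max_i\beta_i$ is the largest coefficient of $\beta$. The Cantor–Bendixson rank $\mathrm{CB}(\alpha)$ of $\alpha>0$ is the least $i$ with $\alpha_i\neq0$ (the smallest exponent in the Cantor normal form), and $\mathrm{CB}(0)=0$. For $n\in\omega$, $L_n=\{\alpha<\omega^\omega:\mathrm{CB}(\alpha)=n\}$, and $L_m=\emptyset$ for $m<0$. Write $\beta\sqsubset\alpha$ if $\alpha=\beta+\omega^\gamma$ for some nonzero ordinal $\gamma>\mathrm{CB}(\beta)$. (So for $\alpha\in L_{n-1}$, $\alpha+\omega^n$ is the immediate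 $\sqsubset$-successor of $\alpha$.) A triangle is a set of three vertices pairwise joined by edges. -}

module Defs where

open import Data.Nat using (ℕ; zero; suc; _<_; _≤_; _>_; _∸_; _+_; _⊔_; NonZero)
open import Data.List using (List; []; _∷_; foldr)
open import Data.Product using (_×_; ∃-syntax)
open import Data.Sum using (_⊎_)
open import Data.Unit using (⊤)
open import Data.Empty using (⊥)
open import Relation.Nullary using (¬_)
open import Relation.Binary.PropositionalEquality using (_≡_)

-- Ordinals below ω^ω in Cantor normal form, stored as the list of
-- coefficients [α₀, α₁, …, α_k] (lowest exponent first), with no
-- trailing zero coefficient (so the representation is unique; 0 = []).
Canon : List ℕ → Set
Canon []           = ⊤
Canon (x ∷ [])     = NonZero x
Canon (x ∷ y ∷ ys) = Canon (y ∷ ys)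

record Ord : Set where
  constructor mk
  field
    cs    : List ℕ
    canon : Canon cs
open Ord public

coefL : List ℕ → ℕ → ℕ
coefL []       i       = 0
coefL (x ∷ xs) zero    = x
coefL (x ∷ xs) (suc i) = coefL xs i

coef : Ord → ℕ → ℕ
coef α i = coefL (cs α) i

maxCoef : Ord → ℕ
maxCoef α = foldr _⊔_ 0 (cs α)

-- Cantor–Bendixson rank: least i with α_i ≠ 0, and CB(0) = 0
cbL : List ℕ → ℕ
cbL []            = 0
cbL (zero ∷ xs)   = suc (cbL xs)
cbL (suc x ∷ xs)  = 0

CB : Ord → ℕ
CB α = cbL (cs α)

_<ₒ_ : Ord → Ord → Set
α <ₒ β = ∃[ k ] (coef α k < coef β k × (∀ j → k < j → coef α j ≡ coef β j))

plusωL : List ℕ → ℕ → List ℕ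
plusωL []       zero    = 1 ∷ []
plusωL []       (suc n) = 0 ∷ plusωL [] n
plusωL (x ∷ xs) zero    = suc x ∷ xs
plusωL (x ∷ xs) (suc n) = 0 ∷ plusωL xs n

IsPlusω : Ord → ℕ → Ord → Set
IsPlusω α n β = cs β ≡ plusωL (cs α) n

-- β ⊏ α  iff  α = β + ω^γ for some nonzero γ > CB(β)
-- (γ necessarily finite since α < ω^ω)
_⊏_ : Ord → Ord → Set
β ⊏ α = ∃[ γ ] (1 ≤ γ × CB β < γ × IsPlusω β γ α)

-- α ∈ L_{n-k}  (L_m = ∅ for m < 0)
InL : ℕ → ℕ → Ord → Set
InL n k α = k ≤ n × CB α ≡ n ∸ k

E1 : ℕ → Ord → Ord → Set
E1 n α β = InL n 1 α × InL n 0 β × IsPlusω α n β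

E2 : ℕ → Ord → Ord → Set
E2 n α β = InL n 0 α × InL n 2 β × α <ₒ β

E3 : ℕ → Ord → Ord → Set
E3 n α β = InL n 3 α × InL n 0 β × α <ₒ β × ¬ (α ⊏ β)
         × maxCoef β < coef α (n ∸ 1)

E4 : ℕ → Ord → Ord → Set
E4 n α β = InL n 4 α × InL n 0 β × α <ₒ β × ¬ (α ⊏ β)
         × maxCoef β > coef α (n ∸ 1) + coef α (n ∸ 2)

Eω : Ord → Ord → Set
Eω α β = ∃[ n ] ( E1 n α β ⊎ E1 n β α ⊎ E2 n α β ⊎ E2 n β α
                ⊎ E3 n α β ⊎ E3 n β α ⊎ E4 n α β ⊎ E4 n β α )

TriangleFree : (Ord → Ord → Set) → Set
TriangleFree E = ∀ a b c → ¬ (a ≡ b) → ¬ (b ≡ c) → ¬ (a ≡ c)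
               → E a b → E b c → E a c → ⊥

-- Every edge of G_ω joins vertices of different Cantor–Bendixson rank, the
-- rank going up by exactly i along an edge of E^n_i; orient it that way.  The
-- three vertices of a triangle then have distinct ranks p < q < r, and the span
-- of the long side p → r is the sum of the spans of the short sides, so the
-- spans of the short sides are (1,1), (2,2), (1,2), (2,1), (1,3) or (3,1).
-- The first two contradict the ordinal order, since E_1 goes up and E_2 goes
-- down in it.  The mixed ones rest on the fact that any γ with
-- α < γ < α + ω^m agrees with α from the coefficient of ω^m on: for (1,2) this
-- forces γ into rank < m, for (2,1) it gives γ + ω^m = α + ω^m, i.e. γ ⊏ α + ω^m.
-- The last two contradict the bounds on max_i β_i in E_3 and E_4.
module Submission where

open import Defs
open import Data.Nat using (ℕ; zero; suc; _<_; _≤_; _+_; _⊔_; z≤n; s≤s; s≤s⁻¹; ≢-nonZero⁻¹; _≤?_)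
open import Data.Nat.Properties
open import Data.List using ([]; _∷_; foldr)
open import Data.Product using (∃-syntax; _,_; proj₁)
open import Data.Sum using (_⊎_; inj₁; inj₂)
open import Data.Unit using (tt)
open import Data.Empty using (⊥; ⊥-elim)
open import Relation.Nullary using (¬_; yes; no)
open import Relation.Binary.PropositionalEquality

coefL-plusωL-< : ∀ xs {n j} → j < n → coefL (plusωL xs n) j ≡ 0
coefL-plusωL-< []       {suc n} {zero}  _         = refl
coefL-plusωL-< (x ∷ xs) {suc n} {zero}  _         = refl
coefL-plusωL-< []       {suc n} {suc j} (s≤s j<n) = coefL-plusωL-< [] j<n
coefL-plusωL-< (x ∷ xs) {suc n} {suc j} (s≤s j<n) = coefL-plusωL-< xs j<n

coefL-plusωL-≡ : ∀ xs n → coefL (plusωL xs n) n ≡ suc (coefL xs n)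
coefL-plusωL-≡ []       zero    = refl
coefL-plusωL-≡ []       (suc n) = coefL-plusωL-≡ [] n
coefL-plusωL-≡ (x ∷ xs) zero    = refl
coefL-plusωL-≡ (x ∷ xs) (suc n) = coefL-plusωL-≡ xs n

coefL-plusωL-> : ∀ xs {n j} → n < j → coefL (plusωL xs n) j ≡ coefL xs j
coefL-plusωL-> []       {zero}  {suc j} _         = refl
coefL-plusωL-> (x ∷ xs) {zero}  {suc j} _         = refl
coefL-plusωL-> []       {suc n} {suc j} (s≤s n<j) = coefL-plusωL-> [] n<j
coefL-plusωL-> (x ∷ xs) {suc n} {suc j} (s≤s n<j) = coefL-plusωL-> xs n<j

maxL-plusωL : ∀ xs n → foldr _⊔_ 0 (plusωL xs n) ≤ suc (foldr _⊔_ 0 xs)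
maxL-plusωL []       zero    = ≤-refl
maxL-plusωL []       (suc n) = maxL-plusωL [] n
maxL-plusωL (x ∷ xs) zero    = ⊔-monoʳ-≤ (suc x) (n≤1+n (foldr _⊔_ 0 xs))
maxL-plusωL (x ∷ xs) (suc n) = ≤-trans (maxL-plusωL xs n) (s≤s (m≤n⊔m x _))

coefL-<-cbL : ∀ xs {i} → i < cbL xs → coefL xs i ≡ 0
coefL-<-cbL (zero ∷ xs) {zero}  _         = refl
coefL-<-cbL (zero ∷ xs) {suc i} (s≤s i<c) = coefL-<-cbL xs i<c

Canon-tail : ∀ {x} xs → Canon (x ∷ xs) → Canon xs
Canon-tail []      _ = tt
Canon-tail (_ ∷ _) c = c

Canon-coefL-zero⇒[] : ∀ xs → Canon xs → (∀ j → coefL xs j ≡ 0) → xs ≡ []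
Canon-coefL-zero⇒[] []           _ _    = refl
Canon-coefL-zero⇒[] (x ∷ [])     c vanish = ⊥-elim (≢-nonZero⁻¹ x {{c}} (vanish 0))
Canon-coefL-zero⇒[] (x ∷ y ∷ ys) c vanish
  with Canon-coefL-zero⇒[] (y ∷ ys) c (λ j → vanish (suc j))
... | ()

Canon-coefL-injective : ∀ xs ys → Canon xs → Canon ys
                      → (∀ j → coefL xs j ≡ coefL ys j) → xs ≡ ys
Canon-coefL-injective []       ys       _  cy eq = sym (Canon-coefL-zero⇒[] ys cy (λ j → sym (eq j)))
Canon-coefL-injective (x ∷ xs) []       cx _  eq = Canon-coefL-zero⇒[] (x ∷ xs) cx eq
Canon-coefL-injective (x ∷ xs) (y ∷ ys) cx cy eq =
  cong₂ _∷_ (eq 0)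
    (Canon-coefL-injective xs ys (Canon-tail xs cx) (Canon-tail ys cy) (λ j → eq (suc j)))

plusωL-cong : ∀ xs ys n → Canon xs → Canon ys
            → (∀ j → n ≤ j → coefL xs j ≡ coefL ys j) → plusωL xs n ≡ plusωL ys n
plusωL-cong xs ys zero cx cy eq =
  cong (λ zs → plusωL zs 0) (Canon-coefL-injective xs ys cx cy (λ j → eq j z≤n))
plusωL-cong []       []       (suc n) _  _  _  = refl
plusωL-cong []       (y ∷ ys) (suc n) _  cy eq =
  cong (0 ∷_) (plusωL-cong [] ys n tt (Canon-tail ys cy) (λ j n≤j → eq (suc j) (s≤s n≤j)))
plusωL-cong (x ∷ xs) []       (suc n) cx _  eq =
  cong (0 ∷_) (plusωL-cong xs [] n (Canon-tail xs cx) tt (λ j n≤j → eq (suc j) (s≤s n≤j)))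
plusωL-cong (x ∷ xs) (y ∷ ys) (suc n) cx cy eq =
  cong (0 ∷_) (plusωL-cong xs ys n (Canon-tail xs cx) (Canon-tail ys cy)
                           (λ j n≤j → eq (suc j) (s≤s n≤j)))

coef-<-CB : ∀ α {i} → i < CB α → coef α i ≡ 0
coef-<-CB α = coefL-<-cbL (cs α)

plusω-coef-< : ∀ {α n β j} → IsPlusω α n β → j < n → coef β j ≡ 0
plusω-coef-< {α} {β = mk _ _} refl = coefL-plusωL-< (cs α)

plusω-coef-≡ : ∀ {α n β} → IsPlusω α n β → coef β n ≡ suc (coef α n)
plusω-coef-≡ {α} {n} {mk _ _} refl = coefL-plusωL-≡ (cs α) n

plusω-coef-> : ∀ {α n β j} → IsPlusω α n β → n < j → coef β j ≡ coef α j
plusω-coef-> {α} {β = mk _ _} refl = coefL-plusωL-> (cs α)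

plusω-maxCoef : ∀ {α n β} → IsPlusω α n β → maxCoef β ≤ suc (maxCoef α)
plusω-maxCoef {α} {n} {mk _ _} refl = maxL-plusωL (cs α) n

plusω-increasing : ∀ {α n β} → IsPlusω α n β → α <ₒ β
plusω-increasing {α} {n} {mk _ _} refl =
  n , ≤-reflexive (sym (coefL-plusωL-≡ (cs α) n)) , λ j n<j → sym (coefL-plusωL-> (cs α) n<j)

<ₒ-irrefl : ∀ {α} → ¬ (α <ₒ α)
<ₒ-irrefl (k , αk<αk , _) = n≮n _ αk<αk

<ₒ-coef-≤ : ∀ {α β j} → (α<β : α <ₒ β) → proj₁ α<β ≤ j → coef α j ≤ coef β j
<ₒ-coef-≤ (k , αk<βk , above) k≤j with m≤n⇒m<n∨m≡n k≤j
... | inj₁ k<j  = ≤-reflexive (above _ k<j)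
... | inj₂ refl = <⇒≤ αk<βk

<ₒ-trans : ∀ {α β γ} → α <ₒ β → β <ₒ γ → α <ₒ γ
<ₒ-trans {α} {β} {γ} α<β@(k₁ , αk<βk , above₁) β<γ@(k₂ , βk<γk , above₂) with ≤-total k₁ k₂
... | inj₁ k₁≤k₂ = k₂ , ≤-<-trans (<ₒ-coef-≤ {α} {β} α<β k₁≤k₂) βk<γk ,
                   λ j k₂<j → trans (above₁ j (≤-<-trans k₁≤k₂ k₂<j)) (above₂ j k₂<j)
... | inj₂ k₂≤k₁ = k₁ , <-≤-trans αk<βk (<ₒ-coef-≤ {β} {γ} β<γ k₂≤k₁) ,
                   λ j k₁<j → trans (above₁ j k₁<j) (above₂ j (≤-<-trans k₂≤k₁ k₁<j))

AgreeAbove : ℕ → Ord → Ord → Set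
AgreeAbove m α β = ∀ j → m < j → coef α j ≡ coef β j

agreeAbove-<-bound : ∀ {m α β k} → AgreeAbove m α β → coef α k < coef β k → k ≤ m
agreeAbove-<-bound α≈β αk<βk = ≮⇒≥ λ m<k → <-irrefl (α≈β _ m<k) αk<βk

<ₒ-between-agreeAbove : ∀ {m α β γ} → α <ₒ β → β <ₒ γ → AgreeAbove m α γ → AgreeAbove m α β
<ₒ-between-agreeAbove {m} {α} {β} {γ} α<β@(k₁ , αk<βk , above₁) β<γ@(k₂ , βk<γk , _) α≈γ j m<j =
  above₁ j (≤-<-trans k₁≤m m<j)
  where
  k₁≤m : k₁ ≤ m
  k₁≤m with ≤-total k₁ k₂
  ... | inj₁ k₁≤k₂ = ≤-trans k₁≤k₂ (agreeAbove-<-bound {m} {α} {γ} α≈γ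
                       (≤-<-trans (<ₒ-coef-≤ {α} {β} α<β k₁≤k₂) βk<γk))
  ... | inj₂ k₂≤k₁ = agreeAbove-<-bound {m} {α} {γ} α≈γ
                       (<-≤-trans αk<βk (<ₒ-coef-≤ {β} {γ} β<γ k₂≤k₁))

<ₒ-agreeAbove-coef-≤ : ∀ {m α β} → α <ₒ β → AgreeAbove m α β → coef α m ≤ coef β m
<ₒ-agreeAbove-coef-≤ {m} {α} {β} α<β@(k , αk<βk , _) α≈β =
  <ₒ-coef-≤ {α} {β} α<β (agreeAbove-<-bound {m} {α} {β} α≈β αk<βk)

<ₒ-agreeAbove-coef-< : ∀ {m α β} → α <ₒ β → AgreeAbove m α β
                     → (∀ j → j < m → coef β j ≡ 0) → coef α m < coef β m
<ₒ-agreeAbove-coef-< {m} {α} {β} (k , αk<βk , _) α≈β βzero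
  with m≤n⇒m<n∨m≡n (agreeAbove-<-bound {m} {α} {β} α≈β αk<βk)
... | inj₁ k<m  = ⊥-elim (n≮0 (subst (_ <_) (βzero k k<m) αk<βk))
... | inj₂ refl = αk<βk

plusω-interval : ∀ {α m β γ} → IsPlusω α m β → α <ₒ γ → γ <ₒ β
               → ∀ j → m ≤ j → coef γ j ≡ coef α j
plusω-interval {α} {m} {β} {γ} α+ω α<γ γ<β j m≤j = agree (m≤n⇒m<n∨m≡n m≤j)
  where
  α≈β : AgreeAbove m α β
  α≈β i m<i = sym (plusω-coef-> {α} {m} {β} α+ω m<i)
  α≈γ : AgreeAbove m α γ
  α≈γ = <ₒ-between-agreeAbove {m} {α} {γ} {β} α<γ γ<β α≈β
  γm<βm : coef γ m < coef β m
  γm<βm = <ₒ-agreeAbove-coef-< {m} {γ} {β} γ<β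
            (λ i m<i → trans (sym (α≈γ i m<i)) (α≈β i m<i))
            (λ i i<m → plusω-coef-< {α} {m} {β} α+ω i<m)
  γm≡αm : coef γ m ≡ coef α m
  γm≡αm = ≤-antisym (s≤s⁻¹ (subst (coef γ m <_) (plusω-coef-≡ {α} {m} {β} α+ω) γm<βm))
                    (<ₒ-agreeAbove-coef-≤ {m} {α} {γ} α<γ α≈γ)
  agree : m < j ⊎ m ≡ j → coef γ j ≡ coef α j
  agree (inj₁ m<j) = sym (α≈γ j m<j)
  agree (inj₂ m≡j) = subst (λ i → coef γ i ≡ coef α i) m≡j γm≡αm

between-plusω⇒⊏ : ∀ {α m β γ} → IsPlusω α m β → α <ₒ γ → γ <ₒ β → 1 ≤ m → CB γ < m → γ ⊏ β
between-plusω⇒⊏ {α} {m} {β} {γ} α+ω α<γ γ<β 1≤m CBγ<m =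
  m , 1≤m , CBγ<m ,
  trans α+ω (plusωL-cong (cs α) (cs γ) m (canon α) (canon γ)
                         (λ j m≤j → sym (plusω-interval {α} {m} {β} {γ} α+ω α<γ γ<β j m≤j)))

no-rank≥-between-plusω : ∀ {α m β γ} → IsPlusω α m β → α <ₒ γ → γ <ₒ β → m ≤ CB γ → ⊥
no-rank≥-between-plusω {α} {m} {β} {γ} α+ω α<γ@(k , αk<γk , _) γ<β m≤CBγ with m ≤? k
... | yes m≤k = <-irrefl (sym (plusω-interval {α} {m} {β} {γ} α+ω α<γ γ<β k m≤k)) αk<γk
... | no  m≰k = n≮0 (subst (coef α k <_) (coef-<-CB γ (<-≤-trans (≰⇒> m≰k) m≤CBγ)) αk<γk)

-- Arc d α β: an edge of E^n_d, oriented from its endpoint α of rank n ∸ d up to β.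
data Arc : ℕ → Ord → Ord → Set where
  arc₁ : ∀ {α β} → CB β ≡ 1 + CB α → IsPlusω α (CB β) β → Arc 1 α β
  arc₂ : ∀ {α β} → CB β ≡ 2 + CB α → β <ₒ α → Arc 2 α β
  arc₃ : ∀ {α β} → CB β ≡ 3 + CB α → α <ₒ β → ¬ (α ⊏ β)
       → maxCoef β < coef α (2 + CB α) → Arc 3 α β
  arc₄ : ∀ {α β} → CB β ≡ 4 + CB α → α <ₒ β
       → coef α (3 + CB α) + coef α (2 + CB α) < maxCoef β → Arc 4 α β

arc-rank : ∀ {d α β} → Arc d α β → CB β ≡ d + CB α
arc-rank (arc₁ r _)     = r
arc-rank (arc₂ r _)     = r
arc-rank (arc₃ r _ _ _) = r
arc-rank (arc₄ r _ _)   = r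

arc-rank-< : ∀ {d α β} → Arc d α β → CB α < CB β
arc-rank-< {suc d} {α} a = subst (CB α <_) (sym (arc-rank a)) (s≤s (m≤n+m (CB α) d))

arc-span-+ : ∀ {d₁ d₂ d₃ p q r} → Arc d₁ p q → Arc d₂ q r → Arc d₃ p r → d₃ ≡ d₁ + d₂
arc-span-+ {d₁} {d₂} {d₃} {p} {q} {r} pq qr pr = +-cancelʳ-≡ (CB p) d₃ (d₁ + d₂) (begin
  d₃ + CB p        ≡⟨ sym (arc-rank pr) ⟩
  CB r             ≡⟨ arc-rank qr ⟩
  d₂ + CB q        ≡⟨ cong (d₂ +_) (arc-rank pq) ⟩
  d₂ + (d₁ + CB p) ≡⟨ sym (+-assoc d₂ d₁ (CB p)) ⟩
  d₂ + d₁ + CB p   ≡⟨ cong (_+ CB p) (+-comm d₂ d₁) ⟩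
  d₁ + d₂ + CB p   ∎)
  where open ≡-Reasoning

no-triangle-1-1 : ∀ {p q r} → Arc 1 p q → Arc 1 q r → Arc 2 p r → ⊥
no-triangle-1-1 {p} {q} {r} (arc₁ _ p+ω) (arc₁ _ q+ω) (arc₂ _ r<p) =
  <ₒ-irrefl {p} (<ₒ-trans {p} {r} {p} p<r r<p)
  where
  p<r : p <ₒ r
  p<r = <ₒ-trans {p} {q} {r} (plusω-increasing {p} {CB q} {q} p+ω)
                             (plusω-increasing {q} {CB r} {r} q+ω)

no-triangle-2-2 : ∀ {p q r} → Arc 2 p q → Arc 2 q r → Arc 4 p r → ⊥
no-triangle-2-2 {p} {q} {r} (arc₂ _ q<p) (arc₂ _ r<q) (arc₄ _ p<r _) =
  <ₒ-irrefl {p} (<ₒ-trans {p} {r} {p} p<r (<ₒ-trans {r} {q} {p} r<q q<p))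

no-triangle-1-2 : ∀ {p q r} → Arc 1 p q → Arc 2 q r → Arc 3 p r → ⊥
no-triangle-1-2 {p} {q} {r} (arc₁ _ p+ω) (arc₂ r-rank r<q) (arc₃ _ p<r _ _) =
  no-rank≥-between-plusω {p} {CB q} {q} {r} p+ω p<r r<q
    (subst (CB q ≤_) (sym r-rank) (m≤n+m (CB q) 2))

no-triangle-2-1 : ∀ {p q r} → Arc 2 p q → Arc 1 q r → Arc 3 p r → ⊥
no-triangle-2-1 {p} {q} {r} (arc₂ _ q<p) (arc₁ _ q+ω) (arc₃ r-rank p<r p⋢r _) =
  p⋢r (between-plusω⇒⊏ {q} {CB r} {r} {p} q+ω q<p p<r
         (subst (1 ≤_) (sym r-rank) (s≤s z≤n))
         (subst (CB p <_) (sym r-rank) (m<n+m (CB p) (s≤s z≤n))))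

no-triangle-1-3 : ∀ {p q r} → Arc 1 p q → Arc 3 q r → Arc 4 p r → ⊥
no-triangle-1-3 {p} {q} {r} (arc₁ q-rank p+ω) (arc₃ _ _ _ r-max<) (arc₄ _ _ <r-max) =
  n≮n (maxCoef r) (begin-strict
  maxCoef r                             <⟨ r-max< ⟩
  coef q (2 + CB q)                     ≡⟨ plusω-coef-> {p} {CB q} {q} p+ω (s≤s (n≤1+n (CB q))) ⟩
  coef p (2 + CB q)                     ≡⟨ cong (λ i → coef p (2 + i)) q-rank ⟩
  coef p (3 + CB p)                     ≤⟨ m≤m+n _ _ ⟩
  coef p (3 + CB p) + coef p (2 + CB p) <⟨ <r-max ⟩
  maxCoef r                             ∎)
  where open ≤-Reasoning

no-triangle-3-1 : ∀ {p q r} → Arc 3 p q → Arc 1 q r → Arc 4 p r → ⊥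
no-triangle-3-1 {p} {q} {r} (arc₃ _ _ _ q-max<) (arc₁ _ q+ω) (arc₄ _ _ <r-max) =
  n≮n (maxCoef r) (begin-strict
  maxCoef r                             ≤⟨ plusω-maxCoef {q} {CB r} {r} q+ω ⟩
  suc (maxCoef q)                       ≤⟨ q-max< ⟩
  coef p (2 + CB p)                     ≤⟨ m≤n+m _ _ ⟩
  coef p (3 + CB p) + coef p (2 + CB p) <⟨ <r-max ⟩
  maxCoef r                             ∎)
  where open ≤-Reasoning

no-transitive-triangle : ∀ {d₁ d₂ p q r} → Arc d₁ p q → Arc d₂ q r → Arc (d₁ + d₂) p r → ⊥
no-transitive-triangle pq@(arc₁ _ _)     qr@(arc₁ _ _)     pr = no-triangle-1-1 pq qr pr
no-transitive-triangle pq@(arc₁ _ _)     qr@(arc₂ _ _)     pr = no-triangle-1-2 pq qr pr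
no-transitive-triangle pq@(arc₁ _ _)     qr@(arc₃ _ _ _ _) pr = no-triangle-1-3 pq qr pr
no-transitive-triangle    (arc₁ _ _)        (arc₄ _ _ _)   ()
no-transitive-triangle pq@(arc₂ _ _)     qr@(arc₁ _ _)     pr = no-triangle-2-1 pq qr pr
no-transitive-triangle pq@(arc₂ _ _)     qr@(arc₂ _ _)     pr = no-triangle-2-2 pq qr pr
no-transitive-triangle    (arc₂ _ _)        (arc₃ _ _ _ _) ()
no-transitive-triangle    (arc₂ _ _)        (arc₄ _ _ _)   ()
no-transitive-triangle pq@(arc₃ _ _ _ _) qr@(arc₁ _ _)     pr = no-triangle-3-1 pq qr pr
no-transitive-triangle    (arc₃ _ _ _ _)    (arc₂ _ _)     ()
no-transitive-triangle    (arc₃ _ _ _ _)    (arc₃ _ _ _ _) ()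
no-transitive-triangle    (arc₃ _ _ _ _)    (arc₄ _ _ _)   ()
no-transitive-triangle    (arc₄ _ _ _)      (arc₁ _ _)     ()
no-transitive-triangle    (arc₄ _ _ _)      (arc₂ _ _)     ()
no-transitive-triangle    (arc₄ _ _ _)      (arc₃ _ _ _ _) ()
no-transitive-triangle    (arc₄ _ _ _)      (arc₄ _ _ _)   ()

_↝_ : Ord → Ord → Set
α ↝ β = ∃[ d ] Arc d α β

↝-no-transitive-triangle : ∀ {p q r} → p ↝ q → q ↝ r → p ↝ r → ⊥
↝-no-transitive-triangle {p} {q} {r} (_ , pq) (_ , qr) (_ , pr) =
  no-transitive-triangle pq qr (subst (λ d → Arc d p r) (arc-span-+ pq qr pr) pr)

↝-no-cycle : ∀ {p q r} → p ↝ q → q ↝ r → r ↝ p → ⊥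
↝-no-cycle {p} (_ , pq) (_ , qr) (_ , rp) =
  n≮n (CB p) (<-trans (<-trans (arc-rank-< pq) (arc-rank-< qr)) (arc-rank-< rp))

E1⇒Arc : ∀ {n α β} → E1 n α β → Arc 1 α β
E1⇒Arc {α = α} {β} ((s≤s _ , CBα) , (_ , CBβ) , α+ω) =
  arc₁ (trans CBβ (cong suc (sym CBα))) (subst (λ m → IsPlusω α m β) (sym CBβ) α+ω)

E2⇒Arc : ∀ {n α β} → E2 n α β → Arc 2 β α
E2⇒Arc ((_ , CBα) , (s≤s (s≤s _) , CBβ) , α<β) = arc₂ (trans CBα (cong (2 +_) (sym CBβ))) α<β

E3⇒Arc : ∀ {n α β} → E3 n α β → Arc 3 α β
E3⇒Arc {α = α} {β} ((s≤s (s≤s (s≤s _)) , CBα) , (_ , CBβ) , α<β , α⋢β , β-max<) =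
  arc₃ (trans CBβ (cong (3 +_) (sym CBα))) α<β α⋢β
       (subst (λ i → maxCoef β < coef α (2 + i)) (sym CBα) β-max<)

E4⇒Arc : ∀ {n α β} → E4 n α β → Arc 4 α β
E4⇒Arc {α = α} {β} ((s≤s (s≤s (s≤s (s≤s _))) , CBα) , (_ , CBβ) , α<β , _ , <β-max) =
  arc₄ (trans CBβ (cong (4 +_) (sym CBα))) α<β
       (subst (λ i → coef α (3 + i) + coef α (2 + i) < maxCoef β) (sym CBα) <β-max)

Eω⇒↝ : ∀ α β → Eω α β → α ↝ β ⊎ β ↝ α
Eω⇒↝ _ _ (_ , inj₁ e)                                           = inj₁ (1 , E1⇒Arc e)
Eω⇒↝ _ _ (_ , inj₂ (inj₁ e))                                    = inj₂ (1 , E1⇒Arc e)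
Eω⇒↝ _ _ (_ , inj₂ (inj₂ (inj₁ e)))                             = inj₂ (2 , E2⇒Arc e)
Eω⇒↝ _ _ (_ , inj₂ (inj₂ (inj₂ (inj₁ e))))                      = inj₁ (2 , E2⇒Arc e)
Eω⇒↝ _ _ (_ , inj₂ (inj₂ (inj₂ (inj₂ (inj₁ e)))))               = inj₁ (3 , E3⇒Arc e)
Eω⇒↝ _ _ (_ , inj₂ (inj₂ (inj₂ (inj₂ (inj₂ (inj₁ e))))))        = inj₂ (3 , E3⇒Arc e)
Eω⇒↝ _ _ (_ , inj₂ (inj₂ (inj₂ (inj₂ (inj₂ (inj₂ (inj₁ e))))))) = inj₁ (4 , E4⇒Arc e)
Eω⇒↝ _ _ (_ , inj₂ (inj₂ (inj₂ (inj₂ (inj₂ (inj₂ (inj₂ e))))))) = inj₂ (4 , E4⇒Arc e)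

mainTheorem5 : TriangleFree Eω
mainTheorem5 a b c _ _ _ ab bc ac with Eω⇒↝ a b ab | Eω⇒↝ b c bc | Eω⇒↝ a c ac
... | inj₁ a↝b | inj₁ b↝c | inj₁ a↝c = ↝-no-transitive-triangle a↝b b↝c a↝c
... | inj₁ a↝b | inj₁ b↝c | inj₂ c↝a = ↝-no-cycle a↝b b↝c c↝a
... | inj₁ a↝b | inj₂ c↝b | inj₁ a↝c = ↝-no-transitive-triangle a↝c c↝b a↝b
... | inj₁ a↝b | inj₂ c↝b | inj₂ c↝a = ↝-no-transitive-triangle c↝a a↝b c↝b
... | inj₂ b↝a | inj₁ b↝c | inj₁ a↝c = ↝-no-transitive-triangle b↝a a↝c b↝c
... | inj₂ b↝a | inj₁ b↝c | inj₂ c↝a = ↝-no-transitive-triangle b↝c c↝a b↝a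
... | inj₂ b↝a | inj₂ c↝b | inj₁ a↝c = ↝-no-cycle a↝c c↝b b↝a
... | inj₂ b↝a | inj₂ c↝b | inj₂ c↝a = ↝-no-transitive-triangle c↝b b↝a c↝a
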